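{- For any integers $2 \leq a \leq b \leq c$ there exists a graph $G$ with $\mathrm{gp}^-(G) = a$, $\mathrm{tp}(G) = \mathrm{tp}^-(G) = b$ and $\mathrm{gp}(G) = c$.
   Context: A set $S \subseteq V(G)$ is in general position if no shortest path of $G$ contains three vertices of $S$. $\mathrm{gp}(G)$ is the order of a largest general position set and $\mathrm{gp}^-(G)$ the order of a smallest maximal (under inclusion) general position set. A terminal set of $G$ is a maximal general position set $S$ such that for every $u \in V(G)\setminus S$ there is a shortest path of $G$ with $u$ as an endpoint containing at least two vertices of $S$. $\mathrm{tp}(G)$ and $\mathrm{tp}^-(G)$ are the orders of a largest and a smallest terminal set, respectively. -}

module Defs where

open import Data.Nat using (ℕ; _≤_)
open import Data.Fin using (Fin)
open import Data.Fin.Subset using (Subset; _∈_; _∉_; _⊆_; ∣_∣)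
open import Data.List using (List; head; last; length)
open import Data.List.Relation.Unary.Linked using (Linked)
import Data.List.Membership.Propositional as L
open import Data.Maybe using (just)
open import Data.Product using (Σ; ∃; _×_)
open import Relation.Binary.PropositionalEquality using (_≡_; _≢_)
open import Relation.Nullary using (¬_)

record Graph : Set₁ where
  field
    n      : ℕ
    Adj    : Fin n → Fin n → Set
    sym    : ∀ {u v} → Adj u v → Adj v u
    irrefl : ∀ {u} → ¬ Adj u u

module _ (G : Graph) where
  open Graph G

  Vertex : Set
  Vertex = Fin n

  IsWalk : Vertex → Vertex → List Vertex → Set
  IsWalk u v xs = Linked Adj xs × head xs ≡ just u × last xs ≡ just v

  Connected : Set
  Connected = ∀ u v → ∃ λ xs → IsWalk u v xs

  IsShortestPath : Vertex → Vertex → List Vertex → Set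
  IsShortestPath u v xs =
    IsWalk u v xs × (∀ ys → IsWalk u v ys → length xs ≤ length ys)

  Contains3 : Subset n → List Vertex → Set
  Contains3 S xs = ∃ λ x → ∃ λ y → ∃ λ z →
    x ≢ y × y ≢ z × x ≢ z ×
    x ∈ S × y ∈ S × z ∈ S ×
    x L.∈ xs × y L.∈ xs × z L.∈ xs

  InGeneralPosition : Subset n → Set
  InGeneralPosition S =
    ∀ u v xs → IsShortestPath u v xs → ¬ Contains3 S xs

  MaximalGP : Subset n → Set
  MaximalGP S = InGeneralPosition S ×
    (∀ T → InGeneralPosition T → S ⊆ T → T ⊆ S)

  Terminal : Subset n → Set
  Terminal S = MaximalGP S ×
    (∀ u → u ∉ S → ∃ λ v → ∃ λ xs → IsShortestPath u v xs ×
       ∃ λ x → ∃ λ y → x ≢ y × x ∈ S × y ∈ S × x L.∈ xs × y L.∈ xs)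

  GpIs : ℕ → Set
  GpIs k = (∃ λ S → InGeneralPosition S × ∣ S ∣ ≡ k) ×
           (∀ T → InGeneralPosition T → ∣ T ∣ ≤ k)

  GpMinusIs : ℕ → Set
  GpMinusIs k = (∃ λ S → MaximalGP S × ∣ S ∣ ≡ k) ×
                (∀ T → MaximalGP T → k ≤ ∣ T ∣)

  TpIs : ℕ → Set
  TpIs k = (∃ λ S → Terminal S × ∣ S ∣ ≡ k) ×
           (∀ T → Terminal T → ∣ T ∣ ≤ k)

  TpMinusIs : ℕ → Set
  TpMinusIs k = (∃ λ S → Terminal S × ∣ S ∣ ≡ k) ×
                (∀ T → Terminal T → k ≤ ∣ T ∣)

-- The witness is a complete multipartite graph with one part of size c and b − 1 parts of
-- size a. Its diameter is 2, so a shortest path through three vertices of a set S is an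
-- induced path x – y – z with x, z in one part and y in another. Hence S is in general
-- position iff it lies inside one part or meets every part at most once. The maximal such
-- sets are the parts (of sizes a and c) and the transversals (of size b). A part is never
-- terminal: a shortest path from a vertex outside it has at most three vertices, and two
-- vertices of the part on it would have to be its last two, which are adjacent. The
-- transversals are terminal.
module Submission where

open import Defs
open import Data.Nat using (ℕ; _≤_)
open import Data.Product using (Σ; _×_)

open import Data.Empty using (⊥-elim)
open import Data.Fin using (Fin; zero; suc; fromℕ<)
open import Data.Fin.Patterns using (0F; 1F; 2F)
open import Data.Fin.Properties
  using (_≟_; any?; suc-injective; injective⇒≤; +↔⊎; *↔×)
open import Data.Fin.Subset
  using (Subset; _∈_; _∉_; _⊆_; ∣_∣; _∪_; ⁅_⁆; inside; outside)
open import Data.Fin.Subset.Properties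
  using (_∈?_; p⊆p∪q; x∈p∪q⁻; x∈p∪q⁺; x∈⁅x⁆; x∈⁅y⁆⇒x≡y; p⊆q⇒∣p∣≤∣q∣)
open import Data.List using (List; []; _∷_; _++_; length; head; lookup)
import Data.List.Membership.Propositional as L
open import Data.List.Membership.Propositional.Properties
  using (∈-++⁻; ∈-++⁺ˡ; ∈-++⁺ʳ)
open import Data.List.Relation.Unary.Any as Any using (index)
open import Data.List.Relation.Unary.Any.Properties using (lookup-index)
open import Data.List.Relation.Unary.Linked using ([-]; _∷_)
open import Data.Maybe using (just)
open import Data.Nat using (z≤n; s≤s; _<_; _+_; _*_)
open import Data.Nat.Properties
  using (≤-refl; ≤-trans; ≤-antisym; ≤-reflexive; <⇒≱; module ≤-Reasoning)
open import Data.Product using (∃; ∃₂; _,_; proj₁; proj₂)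
import Data.Product.Base as Product
open import Data.Sum using (_⊎_; inj₁; inj₂; [_,_]′)
import Data.Sum.Base as Sum
open import Data.Sum.Function.Propositional using (_⊎-↔_)
open import Data.Sum.Properties using (inj₁-injective; inj₂-injective)
open import Data.Vec using (_∷_; []; here; there; tabulate)
open import Data.Vec.Properties using (lookup∘tabulate; []=⇒lookup; lookup⇒[]=)
open import Function using (_∘_; Injective; _↔_; Inverse)
open import Function.Properties.Inverse using (↔-refl; ↔-trans)
open import Level using (Level)
open import Relation.Binary.PropositionalEquality
  using (_≡_; _≢_; refl; sym; trans; cong; subst; ≢-sym)
open import Relation.Nullary using (¬_; yes; no; does; proof; contradiction)
open import Relation.Nullary.Decidable using (dec-true; decidable-stable; _×-dec_; ¬?)
open import Relation.Nullary.Reflects using (Reflects; invert)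
open import Relation.Unary using (Pred; Decidable)

private
  variable
    ℓ : Level
    n m : ℕ
    S T : Subset n

record Enumeration (T : Subset n) : Set where
  field
    element    : Fin ∣ T ∣ → Fin n
    injective  : Injective _≡_ _≡_ element
    element∈   : ∀ i → element i ∈ T
    surjective : ∀ {x} → x ∈ T → ∃ λ i → element i ≡ x

enumerate : (T : Subset n) → Enumeration T
enumerate [] = record
  { element = λ () ; injective = λ { {()} } ; element∈ = λ () ; surjective = λ { {()} } }
enumerate (outside ∷ T) = record
  { element    = suc ∘ element
  ; injective  = injective ∘ suc-injective
  ; element∈   = there ∘ element∈
  ; surjective = λ { (there x∈T) → Product.map₂ (cong suc) (surjective x∈T) }
  }
  where open Enumeration (enumerate T)
enumerate (inside ∷ T) = record
  { element    = λ { zero → zero ; (suc i) → suc (element i) }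
  ; injective  = λ { {zero} {zero} _ → refl
                   ; {suc i} {suc j} e → cong suc (injective (suc-injective e)) }
  ; element∈   = λ { zero → here ; (suc i) → there (element∈ i) }
  ; surjective = λ { here → zero , refl
                   ; (there x∈T) → Product.map suc (cong suc) (surjective x∈T) }
  }
  where open Enumeration (enumerate T)

module _ (T : Subset n) where
  open Enumeration (enumerate T)

  injectiveOn⇒∣p∣≤m : (f : Fin n → Fin m) →
    (∀ {x y} → x ∈ T → y ∈ T → f x ≡ f y → x ≡ y) → ∣ T ∣ ≤ m
  injectiveOn⇒∣p∣≤m f inj = injective⇒≤ λ {i} {j} e →
    injective (inj (element∈ i) (element∈ j) e)

  coveredBy⇒∣p∣≤m : (h : Fin m → Fin n) →
    (∀ {x} → x ∈ T → ∃ λ j → h j ≡ x) → ∣ T ∣ ≤ m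
  coveredBy⇒∣p∣≤m {m} h cover = injective⇒≤ {f = preimage} λ {i} {j} e →
    injective (trans (sym (proj₂ (cover (element∈ i))))
              (trans (cong h e) (proj₂ (cover (element∈ j)))))
    where
    preimage : Fin ∣ T ∣ → Fin m
    preimage i = proj₁ (cover (element∈ i))

  injectiveInto⇒m≤∣p∣ : (h : Fin m → Fin n) → Injective _≡_ _≡_ h →
    (∀ j → h j ∈ T) → m ≤ ∣ T ∣
  injectiveInto⇒m≤∣p∣ {m} h inj h∈T = injective⇒≤ {f = preimage} λ {i} {j} e →
    inj (trans (sym (proj₂ (surjective (h∈T i))))
        (trans (cong element e) (proj₂ (surjective (h∈T j)))))
    where
    preimage : Fin m → Fin ∣ T ∣
    preimage j = proj₁ (surjective (h∈T j))

setOf : {P : Pred (Fin n) ℓ} → Decidable P → Subset n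
setOf P? = tabulate (does ∘ P?)

module _ {P : Pred (Fin n) ℓ} (P? : Decidable P) {x : Fin n} where

  ∈setOf⁺ : P x → x ∈ setOf P?
  ∈setOf⁺ px = lookup⇒[]= x _ (trans (lookup∘tabulate _ x) (dec-true (P? x) px))

  ∈setOf⁻ : x ∈ setOf P? → P x
  ∈setOf⁻ x∈ = invert (subst (Reflects (P x))
    (trans (sym (lookup∘tabulate (does ∘ P?) x)) ([]=⇒lookup x∈)) (proof (P? x)))

∉⇒≢ : ∀ {x y : Fin n} → x ∉ S → y ∈ S → x ≢ y
∉⇒≢ x∉S y∈S refl = x∉S y∈S

∈∪⁅⁆⁻ : ∀ {x w : Fin n} → x ∈ S ∪ ⁅ w ⁆ → x ∈ S ⊎ x ≡ w
∈∪⁅⁆⁻ {S = S} {w = w} = Sum.map₂ (x∈⁅y⁆⇒x≡y w) ∘ x∈p∪q⁻ S ⁅ w ⁆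

∪⁅⁆⊆ : ∀ {w} → S ⊆ T → w ∈ T → S ∪ ⁅ w ⁆ ⊆ T
∪⁅⁆⊆ S⊆T w∈T = [ S⊆T , (λ { refl → w∈T }) ]′ ∘ ∈∪⁅⁆⁻

∈-remove : ∀ {A : Set} {x p : A} ys {zs} →
  x L.∈ ys ++ p ∷ zs → x ≢ p → x L.∈ ys ++ zs
∈-remove ys x∈ x≢p with ∈-++⁻ ys x∈
... | inj₁ x∈ys              = ∈-++⁺ˡ x∈ys
... | inj₂ (Any.here x≡p)    = contradiction x≡p x≢p
... | inj₂ (Any.there x∈zs)  = ∈-++⁺ʳ ys x∈zs

index-injective : ∀ {A : Set} {x y : A} {xs} (x∈ : x L.∈ xs) (y∈ : y L.∈ xs) →
  index x∈ ≡ index y∈ → x ≡ y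
index-injective {xs = xs} x∈ y∈ e =
  trans (lookup-index x∈) (trans (cong (lookup xs) e) (sym (lookup-index y∈)))

module _ (G : Graph) where
  open Graph G using () renaming (n to N)

  Contains3⇒3≤length : ∀ {S : Subset N} {xs} → Contains3 G S xs → 3 ≤ length xs
  Contains3⇒3≤length {xs = xs} (x , y , z , x≢y , y≢z , x≢z , _ , _ , _ , x∈ , y∈ , z∈) =
    injective⇒≤ position-injective
    where
    position : Fin 3 → Fin (length xs)
    position 0F = index x∈
    position 1F = index y∈
    position 2F = index z∈

    position-injective : Injective _≡_ _≡_ position
    position-injective {0F} {0F} _ = refl
    position-injective {1F} {1F} _ = refl
    position-injective {2F} {2F} _ = refl
    position-injective {0F} {1F} e = contradiction (index-injective x∈ y∈ e) x≢y
    position-injective {1F} {0F} e = contradiction (index-injective y∈ x∈ e) (≢-sym x≢y)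
    position-injective {1F} {2F} e = contradiction (index-injective y∈ z∈ e) y≢z
    position-injective {2F} {1F} e = contradiction (index-injective z∈ y∈ e) (≢-sym y≢z)
    position-injective {0F} {2F} e = contradiction (index-injective x∈ z∈ e) x≢z
    position-injective {2F} {0F} e = contradiction (index-injective z∈ x∈ e) (≢-sym x≢z)

  Contains3-remove : ∀ {S : Subset N} {p} ys {zs} → p ∉ S →
    Contains3 G S (ys ++ p ∷ zs) → Contains3 G S (ys ++ zs)
  Contains3-remove ys p∉S (x , y , z , x≢y , y≢z , x≢z , x∈S , y∈S , z∈S , x∈ , y∈ , z∈) =
    x , y , z , x≢y , y≢z , x≢z , x∈S , y∈S , z∈S ,
    ∈-remove ys x∈ (≢-sym (∉⇒≢ p∉S x∈S)) ,
    ∈-remove ys y∈ (≢-sym (∉⇒≢ p∉S y∈S)) ,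
    ∈-remove ys z∈ (≢-sym (∉⇒≢ p∉S z∈S))

  Contains3-short⇒∈ : ∀ {S : Subset N} {p} ys {zs} →
    Contains3 G S (ys ++ p ∷ zs) → length (ys ++ zs) < 3 → p ∈ S
  Contains3-short⇒∈ {S} {p} ys c short = decidable-stable (p ∈? S) λ p∉S →
    <⇒≱ short (Contains3⇒3≤length (Contains3-remove ys p∉S c))

module CompleteMultipartite {k : ℕ} (part : Fin n → Fin k) where

  graph : Graph
  graph = record
    { n      = n
    ; Adj    = λ u v → part u ≢ part v
    ; sym    = ≢-sym
    ; irrefl = λ u≁u → u≁u refl
    }

  partSet : Fin k → Subset n
  partSet i = setOf (λ v → part v ≟ i)

  ∈partSet⁺ : ∀ {x i} → part x ≡ i → x ∈ partSet i
  ∈partSet⁺ = ∈setOf⁺ (λ v → part v ≟ _)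

  ∈partSet⁻ : ∀ {x i} → x ∈ partSet i → part x ≡ i
  ∈partSet⁻ = ∈setOf⁻ (λ v → part v ≟ _)

  PartInjective : Subset n → Set
  PartInjective S = ∀ {x y} → x ∈ S → y ∈ S → part x ≡ part y → x ≡ y

  P₃Free : Subset n → Set
  P₃Free S = ∀ {x y z} → x ∈ S → y ∈ S → z ∈ S →
    x ≢ z → part x ≡ part z → part y ≡ part x

  Transversal : Subset n → Set
  Transversal S = PartInjective S × (∀ w → ∃ λ x → x ∈ S × part x ≡ part w)

  private
    variable
      u v w x y z : Fin n
      xs : List (Fin n)
      i : Fin k

  walk-samePart⇒3≤length : IsWalk graph u v xs → u ≢ v → part u ≡ part v →
    3 ≤ length xs
  walk-samePart⇒3≤length {xs = []} (_ , () , _)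
  walk-samePart⇒3≤length {xs = _ ∷ []} (_ , refl , refl) u≢v _ =
    contradiction refl u≢v
  walk-samePart⇒3≤length {xs = _ ∷ _ ∷ []} (u~v ∷ [-] , refl , refl) _ puv =
    contradiction puv u~v
  walk-samePart⇒3≤length {xs = _ ∷ _ ∷ _ ∷ _} _ _ _ = s≤s (s≤s (s≤s z≤n))

  P₃-shortest : x ≢ z → part x ≡ part z → part x ≢ part y →
    IsShortestPath graph x z (x ∷ y ∷ z ∷ [])
  P₃-shortest x≢z pxz x~y =
    ((x~y ∷ (λ pyz → x~y (trans pxz (sym pyz))) ∷ [-]) , refl , refl) ,
    λ _ walk → walk-samePart⇒3≤length walk x≢z pxz

  gp⇒P₃Free : InGeneralPosition graph S → P₃Free S
  gp⇒P₃Free gp {x} {y} {z} x∈S y∈S z∈S x≢z pxz =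
    decidable-stable (part y ≟ part x) λ y~x → gp x z _ (P₃-shortest x≢z pxz (≢-sym y~x))
      (x , y , z , (λ { refl → y~x refl }) , (λ { refl → y~x (sym pxz) }) , x≢z ,
       x∈S , y∈S , z∈S , Any.here refl , Any.there (Any.here refl) ,
       Any.there (Any.there (Any.here refl)))

  withinPart⇒P₃Free : S ⊆ partSet i → P₃Free S
  withinPart⇒P₃Free S⊆ x∈S y∈S _ _ _ =
    trans (∈partSet⁻ (S⊆ y∈S)) (sym (∈partSet⁻ (S⊆ x∈S)))

  partInjective⇒P₃Free : PartInjective S → P₃Free S
  partInjective⇒P₃Free inj x∈S _ z∈S x≢z pxz =
    contradiction (inj x∈S z∈S pxz) x≢z

  gp⇒partInjective⊎withinPart : InGeneralPosition graph S →
    PartInjective S ⊎ ∃ λ x → x ∈ S × S ⊆ partSet (part x)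
  gp⇒partInjective⊎withinPart {S = S} gp
    with any? (λ x → any? (λ z →
           x ∈? S ×-dec z ∈? S ×-dec ¬? (x ≟ z) ×-dec part x ≟ part z))
  ... | yes (x , z , x∈S , z∈S , x≢z , pxz) =
          inj₂ (x , x∈S , λ y∈S → ∈partSet⁺ (gp⇒P₃Free gp x∈S y∈S z∈S x≢z pxz))
  ... | no noPair = inj₁ λ {x} {y} x∈S y∈S pxy →
          decidable-stable (x ≟ y) λ x≢y → noPair (x , y , x∈S , y∈S , x≢y , pxy)

  partInjective⇒∣S∣≤k : PartInjective S → ∣ S ∣ ≤ k
  partInjective⇒∣S∣≤k {S = S} inj = injectiveOn⇒∣p∣≤m S part inj

  transversal⇒∣S∣≡k : (∀ i → ∃ λ v → part v ≡ i) → Transversal S → ∣ S ∣ ≡ k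
  transversal⇒∣S∣≡k {S = S} surjective (inj , meets) =
    ≤-antisym (partInjective⇒∣S∣≤k inj)
      (injectiveInto⇒m≤∣p∣ S (proj₁ ∘ representative)
        (λ {i} {j} e → trans (sym (proj₂ (proj₂ (representative i))))
                         (trans (cong part e) (proj₂ (proj₂ (representative j)))))
        (λ i → proj₁ (proj₂ (representative i))))
    where
    representative : ∀ i → ∃ λ x → x ∈ S × part x ≡ i
    representative i =
      let v , pv = surjective i
          x , x∈S , px = meets v
      in x , x∈S , trans px pv

  module _ (neighbour : ∀ u → ∃ λ w → part u ≢ part w) where

    walk≤3 : ∀ u v → ∃ λ xs → IsWalk graph u v xs × length xs ≤ 3
    walk≤3 u v with part u ≟ part v
    ... | no u~v = u ∷ v ∷ [] , ((u~v ∷ [-]) , refl , refl) , s≤s (s≤s z≤n)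
    ... | yes puv =
      let w , u~w = neighbour u
      in u ∷ w ∷ v ∷ [] ,
         ((u~w ∷ (λ pwv → u~w (trans puv (sym pwv))) ∷ [-]) , refl , refl) , ≤-refl

    connected : Connected graph
    connected u v = Product.map₂ proj₁ (walk≤3 u v)

    shortest⇒length≤3 : IsShortestPath graph u v xs → length xs ≤ 3
    shortest⇒length≤3 {u} {v} (_ , minimal) =
      ≤-trans (minimal _ (proj₁ (proj₂ (walk≤3 u v)))) (proj₂ (proj₂ (walk≤3 u v)))

    shortest∧Contains3⇒P₃ : IsShortestPath graph u v xs → Contains3 graph S xs →
      ∃ λ w → u ∈ S × w ∈ S × v ∈ S × u ≢ v × part u ≡ part v × part u ≢ part w
    shortest∧Contains3⇒P₃ {xs = []} _ c
      with () ← Contains3⇒3≤length graph c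
    shortest∧Contains3⇒P₃ {xs = _ ∷ []} _ c
      with s≤s () ← Contains3⇒3≤length graph c
    shortest∧Contains3⇒P₃ {xs = _ ∷ _ ∷ []} _ c
      with s≤s (s≤s ()) ← Contains3⇒3≤length graph c
    shortest∧Contains3⇒P₃ {xs = _ ∷ _ ∷ _ ∷ _ ∷ _} sp _
      with s≤s (s≤s (s≤s ())) ← shortest⇒length≤3 sp
    shortest∧Contains3⇒P₃ {u} {v} {u ∷ w ∷ v ∷ []}
      ((u~w ∷ _ ∷ [-] , refl , refl) , minimal) c =
      w , Contains3-short⇒∈ graph [] c ≤-refl ,
      Contains3-short⇒∈ graph (u ∷ []) c ≤-refl ,
      Contains3-short⇒∈ graph (u ∷ w ∷ []) c ≤-refl , u≢v , puv , u~w
      where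
      u≢v : u ≢ v
      u≢v refl with s≤s () ← minimal (u ∷ []) ([-] , refl , refl)

      puv : part u ≡ part v
      puv = decidable-stable (part u ≟ part v) λ u~v →
        <⇒≱ ≤-refl (minimal (u ∷ v ∷ []) ((u~v ∷ [-]) , refl , refl))

    P₃Free⇒gp : P₃Free S → InGeneralPosition graph S
    P₃Free⇒gp free u v xs sp c =
      let w , u∈S , w∈S , v∈S , u≢v , puv , u~w = shortest∧Contains3⇒P₃ sp c
      in u~w (sym (free u∈S w∈S v∈S u≢v puv))

    maximal⇒∈ : MaximalGP graph S → P₃Free (S ∪ ⁅ w ⁆) → w ∈ S
    maximal⇒∈ {w = w} (_ , maximal) free =
      maximal _ (P₃Free⇒gp free) (p⊆p∪q ⁅ w ⁆) (x∈p∪q⁺ (inj₂ (x∈⁅x⁆ w)))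

    maximal∧withinPart⇒⊇part : MaximalGP graph S → S ⊆ partSet i → partSet i ⊆ S
    maximal∧withinPart⇒⊇part max S⊆ w∈ =
      maximal⇒∈ max (withinPart⇒P₃Free (∪⁅⁆⊆ S⊆ w∈))

    maximal∧partInjective⇒transversal :
      MaximalGP graph S → PartInjective S → Transversal S
    maximal∧partInjective⇒transversal {S = S} max inj = inj , meets
      where
      meets : ∀ w → ∃ λ x → x ∈ S × part x ≡ part w
      meets w with any? (λ x → x ∈? S ×-dec part x ≟ part w)
      ... | yes met = met
      ... | no unmet = w , maximal⇒∈ max (partInjective⇒P₃Free inj′) , refl
        where
        inj′ : PartInjective (S ∪ ⁅ w ⁆)
        inj′ x∈ y∈ pxy with ∈∪⁅⁆⁻ x∈ | ∈∪⁅⁆⁻ y∈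
        ... | inj₁ x∈S  | inj₁ y∈S  = inj x∈S y∈S pxy
        ... | inj₁ x∈S  | inj₂ refl = contradiction (_ , x∈S , pxy) unmet
        ... | inj₂ refl | inj₁ y∈S  = contradiction (_ , y∈S , sym pxy) unmet
        ... | inj₂ refl | inj₂ refl = refl

    maximal⇒⊇part⊎transversal :
      MaximalGP graph S → (∃ λ i → partSet i ⊆ S) ⊎ Transversal S
    maximal⇒⊇part⊎transversal max with gp⇒partInjective⊎withinPart (proj₁ max)
    ... | inj₁ inj          = inj₂ (maximal∧partInjective⇒transversal max inj)
    ... | inj₂ (x , _ , S⊆) = inj₁ (part x , maximal∧withinPart⇒⊇part max S⊆)

    partSet-maximal : part x ≡ i → part y ≡ i → x ≢ y → MaximalGP graph (partSet i)
    partSet-maximal px py x≢y =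
      P₃Free⇒gp (withinPart⇒P₃Free (λ w∈ → w∈)) ,
      λ T gp ⊆T w∈T → ∈partSet⁺ (trans
        (gp⇒P₃Free gp (⊆T (∈partSet⁺ px)) w∈T (⊆T (∈partSet⁺ py)) x≢y (trans px (sym py)))
        px)

    transversal⇒P₃ : Transversal S → ∀ u →
      ∃₂ λ r o → r ∈ S × o ∈ S × part r ≡ part u × part u ≢ part o
    transversal⇒P₃ (_ , meets) u =
      let r , r∈S , pr = meets u
          w , u~w = neighbour u
          o , o∈S , po = meets w
      in r , o , r∈S , o∈S , pr , λ puo → u~w (trans puo po)

    transversal⇒terminal : Transversal S → Terminal graph S
    transversal⇒terminal {S = S} tr@(inj , _) =
      (P₃Free⇒gp (partInjective⇒P₃Free inj) , maximal) , terminal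
      where
      maximal : ∀ T → InGeneralPosition graph T → S ⊆ T → T ⊆ S
      maximal T gp S⊆T {w} w∈T =
        let r , o , r∈S , o∈S , pr , w~o = transversal⇒P₃ tr w
        in decidable-stable (w ∈? S) λ w∉S → w~o (sym
             (gp⇒P₃Free gp w∈T (S⊆T o∈S) (S⊆T r∈S) (∉⇒≢ w∉S r∈S) (sym pr)))

      terminal : ∀ u → u ∉ S → ∃ λ v → ∃ λ xs → IsShortestPath graph u v xs ×
        ∃ λ x → ∃ λ y → x ≢ y × x ∈ S × y ∈ S × x L.∈ xs × y L.∈ xs
      terminal u u∉S =
        let r , o , r∈S , o∈S , pr , u~o = transversal⇒P₃ tr u
        in r , _ , P₃-shortest (∉⇒≢ u∉S r∈S) (sym pr) u~o ,
           o , r , (λ o≡r → u~o (trans (sym pr) (cong part (sym o≡r)))) , o∈S , r∈S ,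
           Any.there (Any.here refl) , Any.there (Any.there (Any.here refl))

    terminal⇒¬withinPart : Terminal graph S → x ∈ S → ¬ S ⊆ partSet (part x)
    -- The path from w carries w and two vertices of S, i.e. three vertices of S ∪ ⁅ w ⁆,
    -- so its far end v lies in the part of w: v is neither w nor, as S sits in another
    -- part, in S.
    terminal⇒¬withinPart {S = S} {x} (_ , terminal) x∈S S⊆ =
      let w , x~w = neighbour x
          w∉S : w ∉ S
          w∉S w∈S = x~w (sym (∈partSet⁻ (S⊆ w∈S)))
          v , xs , sp , y , z , y≢z , y∈S , z∈S , y∈ , z∈ = terminal w w∉S
          c : Contains3 graph (S ∪ ⁅ w ⁆) xs
          c = w , y , z , ∉⇒≢ w∉S y∈S , y≢z , ∉⇒≢ w∉S z∈S ,
              x∈p∪q⁺ (inj₂ (x∈⁅x⁆ w)) , x∈p∪q⁺ (inj₁ y∈S) , x∈p∪q⁺ (inj₁ z∈S) ,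
              ∈-head xs (proj₁ (proj₂ (proj₁ sp))) , y∈ , z∈
          _ , _ , _ , v∈ , w≢v , pwv , _ = shortest∧Contains3⇒P₃ sp c
      in [ (λ v∈S → x~w (trans (sym (∈partSet⁻ (S⊆ v∈S))) (sym pwv)))
         , (λ v≡w → w≢v (sym v≡w)) ]′ (∈∪⁅⁆⁻ v∈)
      where
      ∈-head : ∀ {x} xs → head xs ≡ just x → x L.∈ xs
      ∈-head (_ ∷ _) refl = Any.here refl

    terminal⇒transversal : Terminal graph S → Transversal S
    terminal⇒transversal term@(max , _) with gp⇒partInjective⊎withinPart (proj₁ max)
    ... | inj₁ inj            = maximal∧partInjective⇒transversal max inj
    ... | inj₂ (x , x∈S , S⊆) = ⊥-elim (terminal⇒¬withinPart term x∈S S⊆)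

-- The parameters a and b stand for a + 2 and b + 2 in the theorem: the graph built here is
-- K_{c, a+2, …, a+2} with b + 2 parts.
module Witness (a b c : ℕ) (a≤b : a ≤ b) (b≤c : 2 + b ≤ c) where

  N : ℕ
  N = c + (1 + b) * (2 + a)

  Code : Set
  Code = Fin c ⊎ (Fin (1 + b) × Fin (2 + a))

  code : Fin N ↔ Code
  code = ↔-trans +↔⊎ (↔-refl ⊎-↔ *↔×)

  open Inverse code using (to; from; strictlyInverseˡ; strictlyInverseʳ)

  codePart : Code → Fin (2 + b)
  codePart (inj₁ _)       = zero
  codePart (inj₂ (q , _)) = suc q

  part : Fin N → Fin (2 + b)
  part = codePart ∘ to

  open CompleteMultipartite part
  open ≤-Reasoning

  size : Fin (2 + b) → ℕ
  size zero    = c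
  size (suc _) = 2 + a

  a≤c : 2 + a ≤ c
  a≤c = ≤-trans (s≤s (s≤s a≤b)) b≤c

  a≤size : ∀ i → 2 + a ≤ size i
  a≤size zero    = a≤c
  a≤size (suc _) = ≤-refl

  size≤c : ∀ i → size i ≤ c
  size≤c zero    = ≤-refl
  size≤c (suc _) = a≤c

  vertex : ∀ i → Fin (size i) → Fin N
  vertex zero    j = from (inj₁ j)
  vertex (suc q) j = from (inj₂ (q , j))

  part-vertex : ∀ i j → part (vertex i j) ≡ i
  part-vertex zero    j = cong codePart (strictlyInverseˡ (inj₁ j))
  part-vertex (suc q) j = cong codePart (strictlyInverseˡ (inj₂ (q , j)))

  from-injective : Injective _≡_ _≡_ from
  from-injective {s} {t} e =
    trans (sym (strictlyInverseˡ s)) (trans (cong to e) (strictlyInverseˡ t))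

  vertex-injective : ∀ i → Injective _≡_ _≡_ (vertex i)
  vertex-injective zero    e = inj₁-injective (from-injective e)
  vertex-injective (suc q) {j} {j′} e =
    cong proj₂ (inj₂-injective (from-injective {inj₂ (q , j)} {inj₂ (q , j′)} e))

  vertex-surjective : ∀ x → ∃ λ j → vertex (part x) j ≡ x
  vertex-surjective x with to x in eq
  ... | inj₁ j       = j , trans (cong from (sym eq)) (strictlyInverseʳ x)
  ... | inj₂ (q , j) = j , trans (cong from (sym eq)) (strictlyInverseʳ x)

  ∣partSet∣≡size : ∀ i → ∣ partSet i ∣ ≡ size i
  ∣partSet∣≡size i = ≤-antisym
    (coveredBy⇒∣p∣≤m (partSet i) (vertex i)
      (λ {x} x∈ → subst (λ i → ∃ λ j → vertex i j ≡ x) (∈partSet⁻ x∈)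
                          (vertex-surjective x)))
    (injectiveInto⇒m≤∣p∣ (partSet i) (vertex i) (vertex-injective i)
      (∈partSet⁺ ∘ part-vertex i))

  anchor : Fin (2 + b) → Fin N
  anchor i = vertex i (fromℕ< (≤-trans (s≤s z≤n) (a≤size i)))

  part-anchor : ∀ i → part (anchor i) ≡ i
  part-anchor i = part-vertex i _

  otherPart : Fin (2 + b) → Fin (2 + b)
  otherPart zero    = 1F
  otherPart (suc _) = zero

  otherPart-≢ : ∀ i → i ≢ otherPart i
  otherPart-≢ zero    ()
  otherPart-≢ (suc _) ()

  neighbour : ∀ u → ∃ λ w → part u ≢ part w
  neighbour u = anchor (otherPart (part u)) ,
    λ e → otherPart-≢ (part u) (trans e (part-anchor _))

  isAnchor? : Decidable (λ v → v ≡ anchor (part v))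
  isAnchor? v = v ≟ anchor (part v)

  anchors : Subset N
  anchors = setOf isAnchor?

  anchors-transversal : Transversal anchors
  anchors-transversal = inj , meets
    where
    inj : PartInjective anchors
    inj {x} {y} x∈ y∈ pxy = trans (∈setOf⁻ isAnchor? x∈)
      (trans (cong anchor pxy) (sym (∈setOf⁻ isAnchor? y∈)))
    meets : ∀ w → ∃ λ x → x ∈ anchors × part x ≡ part w
    meets w = anchor (part w) ,
      ∈setOf⁺ isAnchor? (cong anchor (sym (part-anchor (part w)))) ,
      part-anchor (part w)

  ∣transversal∣ : ∀ {S} → Transversal S → ∣ S ∣ ≡ 2 + b
  ∣transversal∣ = transversal⇒∣S∣≡k (λ i → anchor i , part-anchor i)

  ∣gp∣≤c : ∀ T → InGeneralPosition graph T → ∣ T ∣ ≤ c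
  ∣gp∣≤c T gpT with gp⇒partInjective⊎withinPart gpT
  ... | inj₁ inj          = ≤-trans (partInjective⇒∣S∣≤k inj) b≤c
  ... | inj₂ (x , _ , T⊆) = begin
    ∣ T ∣                ≤⟨ p⊆q⇒∣p∣≤∣q∣ T⊆ ⟩
    ∣ partSet (part x) ∣ ≡⟨ ∣partSet∣≡size (part x) ⟩
    size (part x)        ≤⟨ size≤c (part x) ⟩
    c                    ∎

  a≤∣maximal∣ : ∀ T → MaximalGP graph T → 2 + a ≤ ∣ T ∣
  a≤∣maximal∣ T max with maximal⇒⊇part⊎transversal neighbour max
  ... | inj₁ (i , part⊆T) = begin
    2 + a         ≤⟨ a≤size i ⟩
    size i        ≡⟨ ∣partSet∣≡size i ⟨
    ∣ partSet i ∣ ≤⟨ p⊆q⇒∣p∣≤∣q∣ part⊆T ⟩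
    ∣ T ∣         ∎
  ... | inj₂ tr = begin
    2 + a ≤⟨ s≤s (s≤s a≤b) ⟩
    2 + b ≡⟨ ∣transversal∣ tr ⟨
    ∣ T ∣ ∎

  smallPart-maximal : MaximalGP graph (partSet 1F)
  smallPart-maximal = partSet-maximal neighbour (part-vertex 1F 0F) (part-vertex 1F 1F)
    (λ e → contradiction (vertex-injective 1F e) λ ())

  anchors-terminal : Terminal graph anchors
  anchors-terminal = transversal⇒terminal neighbour anchors-transversal

  ∣terminal∣ : ∀ T → Terminal graph T → ∣ T ∣ ≡ 2 + b
  ∣terminal∣ T term = ∣transversal∣ (terminal⇒transversal neighbour term)

  gp⁻ : GpMinusIs graph (2 + a)
  gp⁻ = (partSet 1F , smallPart-maximal , ∣partSet∣≡size 1F) , a≤∣maximal∣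

  tp : TpIs graph (2 + b)
  tp = (anchors , anchors-terminal , ∣terminal∣ _ anchors-terminal) ,
       λ T term → ≤-reflexive (∣terminal∣ T term)

  tp⁻ : TpMinusIs graph (2 + b)
  tp⁻ = (anchors , anchors-terminal , ∣terminal∣ _ anchors-terminal) ,
        λ T term → ≤-reflexive (sym (∣terminal∣ T term))

  gp : GpIs graph c
  gp = (partSet zero , P₃Free⇒gp neighbour (withinPart⇒P₃Free (λ x∈ → x∈)) ,
        ∣partSet∣≡size zero) , ∣gp∣≤c

corollary4p5 : ∀ (a b c : ℕ) → 2 ≤ a → a ≤ b → b ≤ c →
    Σ Graph λ G → Connected G ×
      GpMinusIs G a × TpIs G b × TpMinusIs G b × GpIs G c
corollary4p5 _ _ c (s≤s (s≤s _)) (s≤s (s≤s a≤b)) b≤c =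
  graph , connected neighbour , gp⁻ , tp , tp⁻ , gp
  where open Witness _ _ c a≤b b≤c
        open CompleteMultipartite part
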